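{- Let $H_1,\ldots,H_k$ be a sequence (not necessarily distinct) of connected graphs, each of minimum degree at least $2$, each a subgraph of the complete graph on a common vertex set. Let $G$ be the multigraph obtained by overlaying them: $V(G)=\bigcup_i V(H_i)$ and each pair $e$ has multiplicity $|\{i: e\in E(H_i)\}|$ in $G$. Let $E_{\mathrm{sing}}$ be the set of edges of $G$ of multiplicity exactly $1$. Then \[v(G)-\tfrac12|E_{\mathrm{sing}}|\le\tfrac12\sum_{i=1}^k v(H_i),\] with equality if and only if every connected component $K$ of $G$ is of one of the following two types: (i) $K$ is a cycle with all multiplicities $1$ which arises from a single $H_i$ that is a cycle (and no other $H_j$ meets $K$); or (ii) $K$ has all edge multiplicities equal to $2$ and arises from exactly two indices $i\ne j$ with $H_i=H_j$ (identical vertex and edge sets, perfectly overlaid), no other $H_l$ meeting $K$.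
   Context: $v(\cdot)$ denotes the number of vertices. -}

module Defs where

open import Data.Nat using (ℕ; zero; suc; _+_; _*_; _≤_; _<ᵇ_; _≡ᵇ_)
open import Data.Bool using (Bool; true; false; if_then_else_; _∧_; not)
open import Data.Fin using (Fin; zero; suc; toℕ)
open import Data.Product using (Σ; _×_; ∃)
open import Data.Sum using (_⊎_)
open import Relation.Binary.PropositionalEquality using (_≡_; _≢_)
open import Relation.Nullary using (¬_)
open import Function.Bundles using (_⇔_)

count : ∀ {n} → (Fin n → Bool) → ℕ
count {zero}  p = 0
count {suc n} p = (if p zero then 1 else 0) + count (λ i → p (suc i))

sumF : ∀ {k} → (Fin k → ℕ) → ℕ
sumF {zero}  f = 0
sumF {suc k} f = f zero + sumF (λ i → f (suc i))

anyF : ∀ {k} → (Fin k → Bool) → Bool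
anyF p = not (count p ≡ᵇ 0)

record Graph (n : ℕ) : Set where
  field
    V      : Fin n → Bool
    E      : Fin n → Fin n → Bool
    E-sym  : ∀ u w → E u w ≡ E w u
    E-irr  : ∀ u → E u u ≡ false
    E-V    : ∀ u w → E u w ≡ true → V u ≡ true
open Graph public

data Reach {n : ℕ} (A : Fin n → Fin n → Bool) : Fin n → Fin n → Set where
  here : ∀ {u} → Reach A u u
  step : ∀ {u w x} → A u w ≡ true → Reach A w x → Reach A u x

v : ∀ {n} → Graph n → ℕ
v H = count (V H)

deg : ∀ {n} → Graph n → Fin n → ℕ
deg H u = count (E H u)

Connected : ∀ {n} → Graph n → Set
Connected H = ∃ (λ u → V H u ≡ true)
            × (∀ u w → V H u ≡ true → V H w ≡ true → Reach (E H) u w)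

MinDeg≥2 : ∀ {n} → Graph n → Set
MinDeg≥2 H = ∀ u → V H u ≡ true → 2 ≤ deg H u

IsCycle : ∀ {n} → Graph n → Set
IsCycle H = Connected H × (∀ u → V H u ≡ true → deg H u ≡ 2)

module Overlay {n k : ℕ} (H : Fin k → Graph n) where

  VG : Fin n → Bool
  VG u = anyF (λ i → V (H i) u)

  mult : Fin n → Fin n → ℕ
  mult u w = count (λ i → E (H i) u w)

  AdjG : Fin n → Fin n → Bool
  AdjG u w = anyF (λ i → E (H i) u w)

  vG : ℕ
  vG = count VG

  -- |E_sing|: unordered pairs {u,w} (counted once via u < w) of multiplicity 1
  Esing : ℕ
  Esing = sumF (λ u → count (λ w → (toℕ u <ᵇ toℕ w) ∧ (mult u w ≡ᵇ 1)))

  sumV : ℕ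
  sumV = sumF (λ i → v (H i))

  -- the component K of G containing vertex x is { w | Reach AdjG x w }
  InK : Fin n → Fin n → Set
  InK x w = Reach AdjG x w

  Avoids : Fin n → Fin k → Set
  Avoids x j = ∀ w → V (H j) w ≡ true → ¬ InK x w

  SpansK : Fin n → Fin k → Set
  SpansK x i = ∀ w → (V (H i) w ≡ true → InK x w) × (InK x w → V (H i) w ≡ true)

  AllMult : Fin n → ℕ → Set
  AllMult x m = ∀ u w → InK x u → AdjG u w ≡ true → mult u w ≡ m

  TypeI : Fin n → Set
  TypeI x = Σ (Fin k) λ i → IsCycle (H i) × SpansK x i × AllMult x 1
            × (∀ j → j ≢ i → Avoids x j)

  TypeII : Fin n → Set
  TypeII x = Σ (Fin k) λ i → Σ (Fin k) λ j → i ≢ j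
             × SpansK x i × SpansK x j
             × (∀ u w → E (H i) u w ≡ E (H j) u w)
             × AllMult x 2
             × (∀ l → l ≢ i → l ≢ j → Avoids x l)

  AllComponentsGood : Set
  AllComponentsGood = ∀ x → VG x ≡ true → TypeI x ⊎ TypeII x

-- For a vertex u let c(u) be the number of H_i containing u and s(u) the number of
-- singular edges at u. Then 4·[u ∈ G] ≤ 2c(u) + s(u): this is clear unless c(u) = 1,
-- and then every edge of the unique H_i at u is singular, so s(u) ≥ 2 by the degree
-- condition. Summing over u, with Σ c = Σ v(H_i) and Σ s = 2|E_sing|, gives the
-- inequality, with equality iff (c(u), s(u)) ∈ {(0,0), (1,2), (2,0)} for every u.
-- At such a vertex every edge of G has multiplicity c(u), so every H_l through u
-- contains every edge of G at u. Hence the set of H_l through a vertex is constant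
-- on each component of G, which forces type (i) when it is a singleton and
-- type (ii) when it has two elements.
module Submission where

open import Defs
open import Data.Nat using (ℕ; zero; suc; _+_; _*_; _≤_; z≤n; s≤s; _<ᵇ_; _≡ᵇ_)
open import Data.Nat.Properties
  using ( ≤-refl; ≤-trans; ≤-antisym; ≤-reflexive; ≤∧≢⇒<; 1+n≰n; 1+n≢n; m≤m+n
        ; +-mono-≤; +-monoʳ-≤; +-cancelʳ-≤; +-cancelˡ-≡; +-identityʳ; +-suc; suc-injective
        ; *-monoʳ-≤; *-distribˡ-+; *-assoc; *-cancelˡ-≤; *-cancelˡ-≡; ≡ᵇ⇒≡
        ; +-0-commutativeMonoid; +-*-semiring )
open import Data.Bool using (Bool; true; false; if_then_else_; not; _∧_)
open import Data.Bool.Properties using (T-≡; ¬-not; ⇔→≡; ∧-identityʳ)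
open import Data.Fin using (Fin; zero; suc; toℕ; _<_)
open import Data.Fin.Properties using (_≟_; _<?_; <-cmp; <-irrefl)
open import Data.Product using (∃; _×_; _,_; proj₁; proj₂)
open import Data.Sum using (_⊎_; inj₁; inj₂; [_,_])
open import Data.Empty using (⊥-elim)
open import Function using (_∘_; id)
open import Function.Bundles using (_⇔_; mk⇔; Equivalence)
open import Relation.Binary.Definitions using (tri<; tri≈; tri>)
open import Relation.Binary.PropositionalEquality
  using (_≡_; _≢_; _≗_; refl; sym; trans; cong; cong₂; subst; subst₂; module ≡-Reasoning)
open import Relation.Nullary using (¬_; yes; no; does)
open import Relation.Nullary.Decidable using (dec-true; dec-false; decidable-stable)
open import Algebra.Properties.CommutativeMonoid.Sum +-0-commutativeMonoid
  using (sum; sum-syntax; sum-cong-≗; ∑-distrib-+; ∑-comm)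
open import Algebra.Properties.Semiring.Sum +-*-semiring using (*-distribˡ-sum)

𝟙 : Bool → ℕ
𝟙 b = if b then 1 else 0

𝟙-mono : ∀ {a b} → (a ≡ true → b ≡ true) → 𝟙 a ≤ 𝟙 b
𝟙-mono {false} _ = z≤n
𝟙-mono {true} {true} _ = ≤-refl
𝟙-mono {true} {false} a⇒b with a⇒b refl
... | ()

𝟙-injective : ∀ {a b} → 𝟙 a ≡ 𝟙 b → a ≡ b
𝟙-injective {false} {false} _ = refl
𝟙-injective {true} {true} _ = refl

≡ᵇ-true⇒≡ : ∀ {m n} → (m ≡ᵇ n) ≡ true → m ≡ n
≡ᵇ-true⇒≡ {m} {n} e = ≡ᵇ⇒≡ m n (Equivalence.from T-≡ e)

sumF≡sum : ∀ {k} (f : Fin k → ℕ) → sumF f ≡ sum f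
sumF≡sum {zero} f = refl
sumF≡sum {suc k} f = cong (f zero +_) (sumF≡sum (f ∘ suc))

count≡sum : ∀ {n} (p : Fin n → Bool) → count p ≡ sum (𝟙 ∘ p)
count≡sum {zero} p = refl
count≡sum {suc n} p = cong (𝟙 (p zero) +_) (count≡sum (p ∘ suc))

sumF-count≡∑∑ : ∀ {k n} (P : Fin k → Fin n → Bool) →
                sumF (λ i → count (P i)) ≡ ∑[ i < k ] ∑[ u < n ] 𝟙 (P i u)
sumF-count≡∑∑ P = trans (sumF≡sum (λ i → count (P i))) (sum-cong-≗ (λ i → count≡sum (P i)))

sumF-count-comm : ∀ {k n} (P : Fin k → Fin n → Bool) →
                  sumF (λ i → count (P i)) ≡ sumF (λ u → count (λ i → P i u))
sumF-count-comm P =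
  trans (sumF-count≡∑∑ P) (trans (∑-comm (λ i u → 𝟙 (P i u))) (sym (sumF-count≡∑∑ (λ u i → P i u))))

sum-mono-≤ : ∀ {k} {f g : Fin k → ℕ} → (∀ i → f i ≤ g i) → sum f ≤ sum g
sum-mono-≤ {zero} _ = z≤n
sum-mono-≤ {suc k} f≤g = +-mono-≤ (f≤g zero) (sum-mono-≤ (f≤g ∘ suc))

sum-≤-≡⇒≗ : ∀ {k} {f g : Fin k → ℕ} → (∀ i → f i ≤ g i) → sum f ≡ sum g → f ≗ g
sum-≤-≡⇒≗ {suc k} {f} {g} f≤g eq = λ where
    zero → head≡
    (suc i) → sum-≤-≡⇒≗ (f≤g ∘ suc) tail≡ i
  where
  head≡ : f zero ≡ g zero
  head≡ = ≤-antisym (f≤g zero)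
    (+-cancelʳ-≤ (sum (g ∘ suc)) (g zero) (f zero)
      (≤-trans (≤-reflexive (sym eq)) (+-monoʳ-≤ (f zero) (sum-mono-≤ (f≤g ∘ suc)))))
  tail≡ : sum (f ∘ suc) ≡ sum (g ∘ suc)
  tail≡ = +-cancelˡ-≡ (g zero) _ _ (subst (λ a → a + sum (f ∘ suc) ≡ _) head≡ eq)

_⊆ᵇ_ : ∀ {n} → (Fin n → Bool) → (Fin n → Bool) → Set
p ⊆ᵇ q = ∀ i → p i ≡ true → q i ≡ true

module _ {n : ℕ} {p q : Fin n → Bool} where

  count-cong : p ≗ q → count p ≡ count q
  count-cong p≗q = trans (count≡sum p) (trans (sum-cong-≗ (cong 𝟙 ∘ p≗q)) (sym (count≡sum q)))

  count-mono : p ⊆ᵇ q → count p ≤ count q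
  count-mono p⊆q = subst₂ _≤_ (sym (count≡sum p)) (sym (count≡sum q))
                          (sum-mono-≤ (λ i → 𝟙-mono (p⊆q i)))

  count-⊆-≥⇒⊇ : p ⊆ᵇ q → count q ≤ count p → q ⊆ᵇ p
  count-⊆-≥⇒⊇ p⊆q q≤p i qi = trans (𝟙-injective (same i)) qi
    where
    same : 𝟙 ∘ p ≗ 𝟙 ∘ q
    same = sum-≤-≡⇒≗ (λ i → 𝟙-mono (p⊆q i))
             (trans (sym (count≡sum p)) (trans (≤-antisym (count-mono p⊆q) q≤p) (count≡sum q)))

count-none : ∀ {n} (p : Fin n → Bool) → (∀ i → p i ≡ false) → count p ≡ 0
count-none {zero} _ _ = refl
count-none {suc n} p none rewrite none zero = count-none (p ∘ suc) (none ∘ suc)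

count-witness : ∀ {n} (p : Fin n → Bool) → 1 ≤ count p → ∃ λ i → p i ≡ true
count-witness {suc n} p pos with p zero in p₀
... | true = zero , p₀
... | false with count-witness (p ∘ suc) pos
...   | i , pi = suc i , pi

_∖_ : ∀ {n} → (Fin n → Bool) → Fin n → Fin n → Bool
(p ∖ i) j = p j ∧ not (does (j ≟ i))

module _ {n : ℕ} {p : Fin n → Bool} where

  ∖-intro : ∀ {i j} → p j ≡ true → j ≢ i → (p ∖ i) j ≡ true
  ∖-intro {i} {j} pj j≢i rewrite pj | dec-false (j ≟ i) j≢i = refl

  ∖-elim : ∀ {i j} → (p ∖ i) j ≡ true → p j ≡ true × j ≢ i
  ∖-elim {i} {j} e with p j | j ≟ i
  ... | true | no j≢i = refl , j≢i
  ∖-elim () | true | yes _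
  ∖-elim () | false | _

count-∖ : ∀ {n} (p : Fin n → Bool) {i} → p i ≡ true → count p ≡ suc (count (p ∖ i))
count-∖ {suc n} p {zero} pi rewrite pi = cong suc (count-cong (λ j → sym (∧-identityʳ (p (suc j)))))
count-∖ {suc n} p {suc i} pi rewrite ∧-identityʳ (p zero) =
  trans (cong (𝟙 (p zero) +_) (count-∖ (p ∘ suc) pi)) (+-suc (𝟙 (p zero)) _)

count-pos : ∀ {n} (p : Fin n → Bool) {i} → p i ≡ true → 1 ≤ count p
count-pos p pi = subst (1 ≤_) (sym (count-∖ p pi)) (s≤s z≤n)

module _ {n : ℕ} where

  count≡1 : ∀ (p : Fin n → Bool) {i} → p i ≡ true → (∀ j → p j ≡ true → j ≡ i) → count p ≡ 1
  count≡1 p {i} pi unique = trans (count-∖ p pi) (cong suc (count-none (p ∖ i) removed-false))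
    where
    removed-false : ∀ j → (p ∖ i) j ≡ false
    removed-false j = ¬-not λ e → let (pj , j≢i) = ∖-elim {p = p} e in j≢i (unique j pj)

  count≡1-unique : ∀ (p : Fin n → Bool) {i j} → count p ≡ 1 → p i ≡ true → p j ≡ true → j ≡ i
  count≡1-unique p {i} {j} c≡1 pi pj = decidable-stable (j ≟ i) λ j≢i →
    1+n≰n (subst (1 ≤_) removed≡0 (count-pos (p ∖ i) (∖-intro {p = p} pj j≢i)))
    where
    removed≡0 : count (p ∖ i) ≡ 0
    removed≡0 = suc-injective (trans (sym (count-∖ p pi)) c≡1)

  count≡2 : ∀ (p : Fin n → Bool) {i j} → p i ≡ true → p j ≡ true → i ≢ j →
            (∀ l → p l ≡ true → l ≡ i ⊎ l ≡ j) → count p ≡ 2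
  count≡2 p {i} {j} pi pj i≢j pair =
    trans (count-∖ p pi) (cong suc (count≡1 (p ∖ i) (∖-intro {p = p} pj (i≢j ∘ sym)) only-j))
    where
    only-j : ∀ l → (p ∖ i) l ≡ true → l ≡ j
    only-j l e = let (pl , l≢i) = ∖-elim {p = p} e in [ ⊥-elim ∘ l≢i , id ] (pair l pl)

  count≡2-pair : ∀ (p : Fin n → Bool) {i} → count p ≡ 2 → p i ≡ true →
                 ∃ λ j → i ≢ j × p j ≡ true × (∀ l → p l ≡ true → l ≡ i ⊎ l ≡ j)
  count≡2-pair p {i} c≡2 pi = j , proj₂ (∖-elim {p = p} e) ∘ sym , proj₁ (∖-elim {p = p} e) , pair
    where
    removed≡1 : count (p ∖ i) ≡ 1
    removed≡1 = suc-injective (trans (sym (count-∖ p pi)) c≡2)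
    witness : ∃ λ j → (p ∖ i) j ≡ true
    witness = count-witness (p ∖ i) (≤-reflexive (sym removed≡1))
    j : Fin n
    j = proj₁ witness
    e : (p ∖ i) j ≡ true
    e = proj₂ witness
    pair : ∀ l → p l ≡ true → l ≡ i ⊎ l ≡ j
    pair l pl with l ≟ i
    ... | yes l≡i = inj₁ l≡i
    ... | no l≢i = inj₂ (count≡1-unique (p ∖ i) removed≡1 e (∖-intro {p = p} pl l≢i))

module _ {n : ℕ} {p : Fin n → Bool} where

  anyF-intro : 1 ≤ count p → anyF p ≡ true
  anyF-intro pos with count p | pos
  ... | suc _ | _ = refl

  anyF-elim : anyF p ≡ true → 1 ≤ count p
  anyF-elim e with count p | e
  ... | suc _ | _ = s≤s z≤n

  anyF-false : anyF p ≡ false → count p ≡ 0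
  anyF-false e with count p | e
  ... | zero | _ = refl

module _ {n : ℕ} where

  private
    lt-true : {u w : Fin n} → u < w → (toℕ u <ᵇ toℕ w) ≡ true
    lt-true {u} {w} = dec-true (u <? w)

    lt-false : {u w : Fin n} → ¬ u < w → (toℕ u <ᵇ toℕ w) ≡ false
    lt-false {u} {w} = dec-false (u <? w)

  handshake : (B : Fin n → Fin n → Bool) → (∀ u w → B u w ≡ B w u) → (∀ u → B u u ≡ false) →
              ∑[ u < n ] count (B u) ≡ 2 * sumF (λ u → count (λ w → (toℕ u <ᵇ toℕ w) ∧ B u w))
  handshake B symmetric loopless = begin
    ∑[ u < n ] count (B u)                        ≡⟨ sum-cong-≗ (λ u → count≡sum (B u)) ⟩
    ∑[ u < n ] ∑[ w < n ] 𝟙 (B u w)               ≡⟨ sum-cong-≗ (λ u → sum-cong-≗ (split u)) ⟩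
    ∑[ u < n ] ∑[ w < n ] (X u w + X w u)         ≡⟨ sum-cong-≗ (λ u → ∑-distrib-+ (X u) (λ w → X w u)) ⟩
    ∑[ u < n ] (∑[ w < n ] X u w + ∑[ w < n ] X w u)
                                                  ≡⟨ ∑-distrib-+ (λ u → ∑[ w < n ] X u w) (λ u → ∑[ w < n ] X w u) ⟩
    S + ∑[ u < n ] ∑[ w < n ] X w u               ≡⟨ cong (S +_) (∑-comm X) ⟨
    S + S                                         ≡⟨ cong (S +_) (+-identityʳ S) ⟨
    2 * S                                         ≡⟨ cong (2 *_) (sumF-count≡∑∑ (λ u w → (toℕ u <ᵇ toℕ w) ∧ B u w)) ⟨
    2 * sumF (λ u → count (λ w → (toℕ u <ᵇ toℕ w) ∧ B u w)) ∎
    where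
    open ≡-Reasoning
    X : Fin n → Fin n → ℕ
    X u w = 𝟙 ((toℕ u <ᵇ toℕ w) ∧ B u w)
    S : ℕ
    S = ∑[ u < n ] ∑[ w < n ] X u w
    split : ∀ u w → 𝟙 (B u w) ≡ X u w + X w u
    split u w with <-cmp u w
    ... | tri< u<w _ w≮u rewrite lt-true u<w | lt-false w≮u = sym (+-identityʳ _)
    ... | tri≈ _ refl _ rewrite lt-false {u} {u} (<-irrefl refl) | loopless u = refl
    ... | tri> u≮w _ w<u rewrite lt-false u≮w | lt-true w<u = cong 𝟙 (symmetric u w)

-- The per-vertex inequality and its equality cases

data Tight : ℕ → ℕ → Set where
  tight₀ : Tight 0 0
  tight₁ : Tight 1 2
  tight₂ : Tight 2 0

vertex-bound : ∀ c s → (c ≡ 1 → 2 ≤ s) → 4 * 𝟙 (not (c ≡ᵇ 0)) ≤ 2 * c + s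
vertex-bound zero s _ = z≤n
vertex-bound (suc zero) s single = s≤s (s≤s (single refl))
vertex-bound (suc (suc c)) s _ = ≤-trans (*-monoʳ-≤ 2 (m≤m+n 2 c)) (m≤m+n _ s)

vertex-≡⇒Tight : ∀ c s → 4 * 𝟙 (not (c ≡ᵇ 0)) ≡ 2 * c + s → Tight c s
vertex-≡⇒Tight 0 .0 refl = tight₀
vertex-≡⇒Tight 1 .2 refl = tight₁
vertex-≡⇒Tight 2 .0 refl = tight₂
vertex-≡⇒Tight (suc (suc (suc c))) s eq
  with subst (6 ≤_) (sym eq) (≤-trans (*-monoʳ-≤ 2 (m≤m+n 3 c)) (m≤m+n _ s))
... | s≤s (s≤s (s≤s (s≤s ())))

Tight⇒vertex-≡ : ∀ {c s} → Tight c s → 4 * 𝟙 (not (c ≡ᵇ 0)) ≡ 2 * c + s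
Tight⇒vertex-≡ tight₀ = refl
Tight⇒vertex-≡ tight₁ = refl
Tight⇒vertex-≡ tight₂ = refl

Tight-covered : ∀ {c s} → Tight c s → 1 ≤ c → (c ≡ 1 × s ≡ 2) ⊎ (c ≡ 2 × s ≡ 0)
Tight-covered tight₁ _ = inj₁ (refl , refl)
Tight-covered tight₂ _ = inj₂ (refl , refl)

module OverlayProperties {n k : ℕ} (H : Fin k → Graph n) where
  open Overlay H

  cover : Fin n → ℕ
  cover u = count (λ i → V (H i) u)

  singularDegree : Fin n → ℕ
  singularDegree u = count (λ w → mult u w ≡ᵇ 1)

  mult-sym : ∀ u w → mult u w ≡ mult w u
  mult-sym u w = count-cong (λ i → E-sym (H i) u w)

  mult≤cover : ∀ u w → mult u w ≤ cover u
  mult≤cover u w = count-mono (λ i → E-V (H i) u w)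

  1≤mult⇒Adj : ∀ {u w} → 1 ≤ mult u w → AdjG u w ≡ true
  1≤mult⇒Adj {u} {w} = anyF-intro {p = λ l → E (H l) u w}

  edge⇒Adj : ∀ {i u w} → E (H i) u w ≡ true → AdjG u w ≡ true
  edge⇒Adj {i} {u} {w} e = 1≤mult⇒Adj (count-pos (λ l → E (H l) u w) e)

  Adj-witness : ∀ {u w} → AdjG u w ≡ true → ∃ λ i → E (H i) u w ≡ true
  Adj-witness {u} {w} adj = count-witness (λ l → E (H l) u w) (anyF-elim {p = λ l → E (H l) u w} adj)

  Adj-sym : ∀ u w → AdjG u w ≡ AdjG w u
  Adj-sym u w = cong (λ m → not (m ≡ᵇ 0)) (mult-sym u w)

  Reach-lift : ∀ i {x y} → Reach (E (H i)) x y → InK x y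
  Reach-lift i here = here
  Reach-lift i (step e r) = step (edge⇒Adj e) (Reach-lift i r)

  singular⇒mult≡1 : ∀ {u w} → (mult u w ≡ᵇ 1) ≡ true → mult u w ≡ 1
  singular⇒mult≡1 = ≡ᵇ-true⇒≡

  singular⇒Adj : ∀ {u w} → (mult u w ≡ᵇ 1) ≡ true → AdjG u w ≡ true
  singular⇒Adj m = 1≤mult⇒Adj (≤-reflexive (sym (singular⇒mult≡1 m)))

  ∑-cover : sum cover ≡ sumV
  ∑-cover = trans (sym (sumF≡sum cover)) (sym (sumF-count-comm (λ i u → V (H i) u)))

  ∑-singularDegree : sum singularDegree ≡ 2 * Esing
  ∑-singularDegree = handshake (λ u w → mult u w ≡ᵇ 1)
    (λ u w → cong (_≡ᵇ 1) (mult-sym u w))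
    (λ u → cong (_≡ᵇ 1) (count-none (λ i → E (H i) u u) (λ i → E-irr (H i) u)))

  ∑-weight : ∑[ u < n ] (4 * 𝟙 (VG u)) ≡ 2 * (2 * vG)
  ∑-weight = begin
    ∑[ u < n ] (4 * 𝟙 (VG u))  ≡⟨ *-distribˡ-sum 4 (𝟙 ∘ VG) ⟨
    4 * sum (𝟙 ∘ VG)           ≡⟨ cong (4 *_) (count≡sum VG) ⟨
    4 * vG                     ≡⟨ *-assoc 2 2 vG ⟩
    2 * (2 * vG)               ∎
    where open ≡-Reasoning

  ∑-bound : ∑[ u < n ] (2 * cover u + singularDegree u) ≡ 2 * (sumV + Esing)
  ∑-bound = begin
    ∑[ u < n ] (2 * cover u + singularDegree u)    ≡⟨ ∑-distrib-+ (λ u → 2 * cover u) singularDegree ⟩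
    ∑[ u < n ] (2 * cover u) + sum singularDegree  ≡⟨ cong (_+ sum singularDegree) (*-distribˡ-sum 2 cover) ⟨
    2 * sum cover + sum singularDegree             ≡⟨ cong₂ (λ a b → 2 * a + b) ∑-cover ∑-singularDegree ⟩
    2 * sumV + 2 * Esing                           ≡⟨ *-distribˡ-+ 2 sumV Esing ⟨
    2 * (sumV + Esing)                             ∎
    where open ≡-Reasoning

  -- VG u unfolds to not (cover u ≡ᵇ 0), so this is vertex-bound at (cover u, singularDegree u).
  vertex-inequality : (∀ i → MinDeg≥2 (H i)) → ∀ u → 4 * 𝟙 (VG u) ≤ 2 * cover u + singularDegree u
  vertex-inequality minDeg u = vertex-bound (cover u) (singularDegree u) single-cover
    where
    single-cover : cover u ≡ 1 → 2 ≤ singularDegree u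
    single-cover c≡1 with count-witness (λ i → V (H i) u) (≤-reflexive (sym c≡1))
    ... | i , vi = ≤-trans (minDeg i u vi) (count-mono edge-singular)
      where
      edge-singular : E (H i) u ⊆ᵇ (λ w → mult u w ≡ᵇ 1)
      edge-singular w e = cong (_≡ᵇ 1)
        (≤-antisym (≤-trans (mult≤cover u w) (≤-reflexive c≡1)) (count-pos (λ l → E (H l) u w) e))

  module _ (bound : ∀ u → 4 * 𝟙 (VG u) ≤ 2 * cover u + singularDegree u) where

    overlay-≤ : 2 * vG ≤ sumV + Esing
    overlay-≤ = *-cancelˡ-≤ 2 (subst₂ _≤_ ∑-weight ∑-bound (sum-mono-≤ bound))

    overlay-≡⇒Tight : 2 * vG ≡ sumV + Esing → ∀ u → Tight (cover u) (singularDegree u)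
    overlay-≡⇒Tight eq u = vertex-≡⇒Tight (cover u) (singularDegree u)
      (sum-≤-≡⇒≗ bound (trans ∑-weight (trans (cong (2 *_) eq) (sym ∑-bound))) u)

  Tight⇒overlay-≡ : (∀ u → Tight (cover u) (singularDegree u)) → 2 * vG ≡ sumV + Esing
  Tight⇒overlay-≡ tight = *-cancelˡ-≡ _ _ 2
    (trans (sym ∑-weight) (trans (sum-cong-≗ (Tight⇒vertex-≡ ∘ tight)) ∑-bound))

  module _ (tight : ∀ u → Tight (cover u) (singularDegree u)) where

    edge-mult≡cover : ∀ {u w} → AdjG u w ≡ true → mult u w ≡ cover u
    edge-mult≡cover {u} {w} adj with Adj-witness adj
    ... | i , e = ≤-antisym (mult≤cover u w) cover≤mult
      where
      1≤mult : 1 ≤ mult u w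
      1≤mult = count-pos (λ l → E (H l) u w) e
      not-singular : singularDegree u ≡ 0 → 1 ≢ mult u w
      not-singular s≡0 1≡m = 1+n≰n (subst (1 ≤_) s≡0
        (count-pos (λ w → mult u w ≡ᵇ 1) (cong (_≡ᵇ 1) (sym 1≡m))))
      cover≤mult : cover u ≤ mult u w
      cover≤mult with Tight-covered (tight u) (count-pos (λ l → V (H l) u) (E-V (H i) u w e))
      ... | inj₁ (c≡1 , _) = subst (_≤ mult u w) (sym c≡1) 1≤mult
      ... | inj₂ (c≡2 , s≡0) = subst (_≤ mult u w) (sym c≡2) (≤∧≢⇒< 1≤mult (not-singular s≡0))

    -- Since mult u w ≡ cover u, the H_l containing the edge are all the H_l containing u.
    edge-full : ∀ {u w l} → AdjG u w ≡ true → V (H l) u ≡ true → E (H l) u w ≡ true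
    edge-full {u} {w} {l} adj =
      count-⊆-≥⇒⊇ (λ i → E-V (H i) u w) (≤-reflexive (sym (edge-mult≡cover adj))) l

    membership-step : ∀ {u w} → AdjG u w ≡ true → ∀ l → V (H l) w ≡ V (H l) u
    membership-step {u} {w} adj l = ⇔→≡ (mk⇔ backward forward)
      where
      forward : V (H l) u ≡ true → V (H l) w ≡ true
      forward vu = E-V (H l) w u (trans (E-sym (H l) w u) (edge-full adj vu))
      backward : V (H l) w ≡ true → V (H l) u ≡ true
      backward vw = E-V (H l) u w (trans (E-sym (H l) u w) (edge-full (trans (Adj-sym w u) adj) vw))

    membership-invariant : ∀ {x w} → InK x w → ∀ l → V (H l) w ≡ V (H l) x
    membership-invariant here l = refl
    membership-invariant (step adj r) l = trans (membership-invariant r l) (membership-step adj l)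

    cover-invariant : ∀ {x w} → InK x w → cover w ≡ cover x
    cover-invariant r = count-cong (membership-invariant r)

    module _ (conn : ∀ i → Connected (H i)) where

      spans : ∀ {x l} → V (H l) x ≡ true → SpansK x l
      spans {x} {l} vx w = (λ vw → Reach-lift l (proj₂ (conn l) x w vx vw))
                         , (λ r → trans (membership-invariant r l) vx)

      avoids : ∀ {x l} → ¬ V (H l) x ≡ true → Avoids x l
      avoids {x} {l} ¬vx w vw r = ¬vx (trans (sym (membership-invariant r l)) vw)

      uniform-mult : ∀ x → AllMult x (cover x)
      uniform-mult x u w r adj = trans (edge-mult≡cover adj) (cover-invariant r)

      single-component : ∀ {x i} → V (H i) x ≡ true → cover x ≡ 1 → TypeI x
      single-component {x} {i} vx c≡1 =
        i , (conn i , degree≡2) , spans vx , subst (AllMult x) c≡1 (uniform-mult x)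
          , λ j j≢i → avoids λ vj → j≢i (count≡1-unique (λ l → V (H l) x) c≡1 vx vj)
        where
        degree≡2 : ∀ u → V (H i) u ≡ true → deg (H i) u ≡ 2
        degree≡2 u vu = trans (count-cong edge≡singular) s≡2
          where
          cu≡1 : cover u ≡ 1
          cu≡1 = trans (cover-invariant (proj₁ (spans vx u) vu)) c≡1
          s≡2 : singularDegree u ≡ 2
          s≡2 with Tight-covered (tight u) (≤-reflexive (sym cu≡1))
          ... | inj₁ (_ , s≡2) = s≡2
          ... | inj₂ (c≡2 , _) = ⊥-elim (1+n≢n (trans (sym c≡2) cu≡1))
          edge≡singular : ∀ w → E (H i) u w ≡ (mult u w ≡ᵇ 1)
          edge≡singular w = ⇔→≡ (mk⇔ to from)
            where
            to : E (H i) u w ≡ true → (mult u w ≡ᵇ 1) ≡ true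
            to e = cong (_≡ᵇ 1) (trans (edge-mult≡cover (edge⇒Adj e)) cu≡1)
            from : (mult u w ≡ᵇ 1) ≡ true → E (H i) u w ≡ true
            from m = edge-full (singular⇒Adj m) vu

      edge-shared : ∀ {x a b u w} → V (H a) x ≡ true → V (H b) x ≡ true →
                    E (H a) u w ≡ true → E (H b) u w ≡ true
      edge-shared {x} {a} {b} {u} {w} va vb e = edge-full (edge⇒Adj e)
        (trans (membership-invariant (proj₁ (spans va u) (E-V (H a) u w e)) b) vb)

      double-component : ∀ {x i} → V (H i) x ≡ true → cover x ≡ 2 → TypeII x
      double-component {x} {i} vx c≡2 with count≡2-pair (λ l → V (H l) x) c≡2 vx
      ... | j , i≢j , vjx , pair =
        i , j , i≢j , spans vx , spans vjx
          , (λ u w → ⇔→≡ (mk⇔ (edge-shared vx vjx) (edge-shared vjx vx)))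
          , subst (AllMult x) c≡2 (uniform-mult x)
          , λ l l≢i l≢j → avoids λ vl → [ l≢i , l≢j ] (pair l vl)

      Tight⇒components-good : AllComponentsGood
      Tight⇒components-good x vgx with count-witness (λ i → V (H i) x) (anyF-elim {p = λ i → V (H i) x} vgx)
      ... | i , vx with Tight-covered (tight x) (count-pos (λ l → V (H l) x) vx)
      ...   | inj₁ (c≡1 , _) = inj₁ (single-component vx c≡1)
      ...   | inj₂ (c≡2 , _) = inj₂ (double-component vx c≡2)

  singular⇒covered : ∀ {u w} → (mult u w ≡ᵇ 1) ≡ true → 1 ≤ cover u
  singular⇒covered {u} {w} m = ≤-trans (≤-reflexive (sym (singular⇒mult≡1 m))) (mult≤cover u w)

  TypeI⇒Tight : ∀ {u} → TypeI u → Tight (cover u) (singularDegree u)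
  TypeI⇒Tight {u} (i , (_ , degree≡2) , span , mult≡1 , avoid) =
    subst₂ Tight (sym c≡1) (sym s≡2) tight₁
    where
    vu : V (H i) u ≡ true
    vu = proj₂ (span u) here
    only-i : ∀ j → V (H j) u ≡ true → j ≡ i
    only-i j vj = decidable-stable (j ≟ i) λ j≢i → avoid j j≢i u vj here
    c≡1 : cover u ≡ 1
    c≡1 = count≡1 (λ l → V (H l) u) vu only-i
    singular≡edge : ∀ w → (mult u w ≡ᵇ 1) ≡ E (H i) u w
    singular≡edge w = ⇔→≡ (mk⇔ to from)
      where
      to : (mult u w ≡ᵇ 1) ≡ true → E (H i) u w ≡ true
      to m with Adj-witness (singular⇒Adj m)
      ... | l , e = subst (λ j → E (H j) u w ≡ true) (only-i l (E-V (H l) u w e)) e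
      from : E (H i) u w ≡ true → (mult u w ≡ᵇ 1) ≡ true
      from e = cong (_≡ᵇ 1) (mult≡1 u w here (edge⇒Adj e))
    s≡2 : singularDegree u ≡ 2
    s≡2 = trans (count-cong singular≡edge) (degree≡2 u vu)

  TypeII⇒Tight : ∀ {u} → TypeII u → Tight (cover u) (singularDegree u)
  TypeII⇒Tight {u} (i , j , i≢j , span-i , span-j , _ , mult≡2 , avoid) =
    subst₂ Tight (sym c≡2) (sym s≡0) tight₂
    where
    only-ij : ∀ l → V (H l) u ≡ true → l ≡ i ⊎ l ≡ j
    only-ij l vl with l ≟ i | l ≟ j
    ... | yes l≡i | _ = inj₁ l≡i
    ... | no _ | yes l≡j = inj₂ l≡j
    ... | no l≢i | no l≢j = ⊥-elim (avoid l l≢i l≢j u vl here)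
    c≡2 : cover u ≡ 2
    c≡2 = count≡2 (λ l → V (H l) u) (proj₂ (span-i u) here) (proj₂ (span-j u) here) i≢j only-ij
    not-singular : ∀ w → (mult u w ≡ᵇ 1) ≡ false
    not-singular w = ¬-not λ m →
      let m≡1 = singular⇒mult≡1 m
      in 1+n≢n (trans (sym (mult≡2 u w here (singular⇒Adj m))) m≡1)
    s≡0 : singularDegree u ≡ 0
    s≡0 = count-none (λ w → mult u w ≡ᵇ 1) not-singular

  components-good⇒Tight : AllComponentsGood → ∀ u → Tight (cover u) (singularDegree u)
  components-good⇒Tight good u with VG u in vg
  ... | true = [ TypeI⇒Tight , TypeII⇒Tight ] (good u vg)
  ... | false = subst₂ Tight (sym c≡0) (sym s≡0) tight₀
    where
    c≡0 : cover u ≡ 0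
    c≡0 = anyF-false {p = λ i → V (H i) u} vg
    s≡0 : singularDegree u ≡ 0
    s≡0 = count-none (λ w → mult u w ≡ᵇ 1)
      (λ w → ¬-not λ m → 1+n≰n (subst (1 ≤_) c≡0 (singular⇒covered m)))

lemma3p2 : ∀ {n k} (H : Fin k → Graph n)
    → (∀ i → Connected (H i))
    → (∀ i → MinDeg≥2 (H i))
    → (2 * Overlay.vG H ≤ Overlay.sumV H + Overlay.Esing H)
      × ((2 * Overlay.vG H ≡ Overlay.sumV H + Overlay.Esing H) ⇔ Overlay.AllComponentsGood H)
lemma3p2 H conn minDeg =
  overlay-≤ bound ,
  mk⇔ (λ eq → Tight⇒components-good (overlay-≡⇒Tight bound eq) conn)
      (Tight⇒overlay-≡ ∘ components-good⇒Tight)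
  where
  open OverlayProperties H
  bound : ∀ u → 4 * 𝟙 (Overlay.VG H u) ≤ 2 * cover u + singularDegree u
  bound = vertex-inequality minDeg
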